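{- Let $D$ be a finite or infinite digraph, and let $D^-$ be the digraph obtained from $D$ by deleting all sinks of $D$ (vertices of out-degree $0$). Then: (1) A set $A\subseteq X(D)$ is an arc-reaching set of $D$ if and only if $A=P\cup Q$ where $P$ is a point-reaching set of $D^-$ and $Q$ is a (arbitrary) set of sinks of $D$. (2) The arc-bases of $D$ are exactly the sets $B\setminus I$, where $B$ is a point-basis of $D$ and $I$ is the set of isolates of $D$.
   Context: A digraph $D$ has vertex set $X(D)$ and arc set $\mathcal{U}(D)$ (arcs are ordered pairs of distinct vertices); $D$ may be infinite. A vertex $v$ is reachable from $u$ if there is a directed path (possibly of length $0$) from $u$ to $v$. An isolate is a vertex of in-degree and out-degree $0$; a sink is a vertex of out-degree $0$. A point-reaching set of $D$ is a set $S\subseteq X(D)$ such that every vertex of $D$ is reachable from some vertex of $S$; a point-basis is an inclusion-minimal point-reaching set. An arc-reaching set of $D$ is a set $S\subseteq X(D)$ such that for every arc $(u,v)$ of $D$ the vertex $u$ is reachable from some vertex of $S$ (equivalently, some directed walk starting in $S$ contains the arc); an arc-basis is an inclusion-minimal arc-reaching set. -}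

module Defs where

open import Level using (0ℓ)
open import Data.Product using (Σ; ∃; _×_; _,_; proj₁)
open import Data.Sum using (_⊎_)
open import Relation.Nullary using (¬_)
open import Relation.Unary using (Pred; _∈_; _⊆_; _≐_; _∖_)

record Digraph : Set₁ where
  field
    Vertex : Set
    Arc    : Vertex → Vertex → Set
    irrefl : ∀ {u} → ¬ Arc u u
open Digraph public

VSet : Digraph → Set₁
VSet D = Pred (Vertex D) 0ℓ

data Reach (D : Digraph) : Vertex D → Vertex D → Set where
  here : ∀ {u} → Reach D u u
  step : ∀ {u w v} → Arc D u w → Reach D w v → Reach D u v

Sink : (D : Digraph) → Pred (Vertex D) 0ℓ
Sink D u = ¬ (∃ λ v → Arc D u v)

Isolate : (D : Digraph) → Pred (Vertex D) 0ℓ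
Isolate D u = (¬ (∃ λ v → Arc D u v)) × (¬ (∃ λ w → Arc D w u))

delSinks : Digraph → Digraph
delSinks D = record
  { Vertex = Σ (Vertex D) (λ u → ¬ Sink D u)
  ; Arc    = λ u v → Arc D (proj₁ u) (proj₁ v)
  ; irrefl = irrefl D
  }

PointReaching : (D : Digraph) → VSet D → Set
PointReaching D S = ∀ v → ∃ λ s → s ∈ S × Reach D s v

ArcReaching : (D : Digraph) → VSet D → Set
ArcReaching D S = ∀ u v → Arc D u v → ∃ λ s → s ∈ S × Reach D s u

Minimal : (D : Digraph) → (VSet D → Set) → VSet D → Set₁
Minimal D R S = R S × (∀ (S' : VSet D) → S' ⊆ S → R S' → S ⊆ S')

PointBasis : (D : Digraph) → VSet D → Set₁
PointBasis D = Minimal D (PointReaching D)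

ArcBasis : (D : Digraph) → VSet D → Set₁
ArcBasis D = Minimal D (ArcReaching D)

-- the subset of X(D) given by P ∪ Q, where P ⊆ X(D⁻) and Q ⊆ X(D)
embUnion : (D : Digraph) → VSet (delSinks D) → VSet D → VSet D
embUnion D P Q x = (∃ λ (p : ¬ Sink D x) → (x , p) ∈ P) ⊎ x ∈ Q

-- (1) An arc is reached exactly when its tail is, and tails are the non-sinks. A path ending
-- at a non-sink passes through non-sinks only, so it is a path of D⁻; hence A is arc-reaching
-- iff its non-sinks point-reach D⁻, and the sinks in A are irrelevant.
-- (2) Every point-reaching set contains all isolates, and dropping them leaves an arc-reaching
-- set. Conversely a vertex not reached from an arc-reaching set has no in- and no out-arcs, so
-- adding the isolates makes an arc-reaching set point-reaching. The maps S ↦ S ∖ I and S ↦ S ∪ I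
-- therefore exchange point-bases and arc-bases.
module Submission where

open import Defs
open import Level using (0ℓ)
open import Data.Product using (Σ; ∃; _×_; _,_; proj₁; proj₂)
open import Data.Sum using (inj₁; inj₂)
open import Data.Empty using (⊥-elim)
open import Function.Base using (_∘_)
open import Function.Bundles using (_⇔_; mk⇔; module Equivalence)
open import Relation.Nullary using (¬_; yes; no)
open import Relation.Unary using (_⊆_; _≐_; _∖_; _∪_; _∩_)
open import Relation.Binary.PropositionalEquality using (_≡_; refl)
open import Axiom.ExcludedMiddle using (ExcludedMiddle)

module _ (D : Digraph) where

  reach-forget : ∀ {s t} → Reach (delSinks D) s t → Reach D (proj₁ s) (proj₁ t)
  reach-forget here       = here
  reach-forget (step a r) = step a (reach-forget r)

  reach-lift : ∀ {s v} → Reach D s v → (v∉Sink : ¬ Sink D v) →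
               Σ (¬ Sink D s) λ s∉Sink → Reach (delSinks D) (s , s∉Sink) (v , v∉Sink)
  reach-lift here       v∉Sink = v∉Sink , here
  reach-lift (step a r) v∉Sink = (λ noOut → noOut (_ , a)) , step a (proj₂ (reach-lift r v∉Sink))

  reach-snoc : ∀ {s u v} → Reach D s u → Arc D u v → Reach D s v
  reach-snoc here       a = step a here
  reach-snoc (step b r) a = step b (reach-snoc r a)

  reach-into-sourceless : ∀ {s v} → Reach D s v → ¬ (∃ λ w → Arc D w v) → s ≡ v
  reach-into-sourceless here       _    = refl
  reach-into-sourceless (step a r) noIn with reach-into-sourceless r noIn
  ... | refl = ⊥-elim (noIn (_ , a))

  reach-tail⇒¬Isolate : ∀ {s u v} → Reach D s u → Arc D u v → ¬ Isolate D s
  reach-tail⇒¬Isolate here       a (noOut , _) = noOut (_ , a)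
  reach-tail⇒¬Isolate (step b _) _ (noOut , _) = noOut (_ , b)

  PointReaching-mono : ∀ {S T : VSet D} → S ⊆ T → PointReaching D S → PointReaching D T
  PointReaching-mono S⊆T pr v with pr v
  ... | s , s∈S , r = s , S⊆T s∈S , r

  ArcReaching-mono : ∀ {S T : VSet D} → S ⊆ T → ArcReaching D S → ArcReaching D T
  ArcReaching-mono S⊆T ar u v a with ar u v a
  ... | s , s∈S , r = s , S⊆T s∈S , r

  ArcReaching⇔PointReaching⁻ : ExcludedMiddle 0ℓ → (A : VSet D) →
    ArcReaching D A ⇔ PointReaching (delSinks D) (A ∘ proj₁)
  ArcReaching⇔PointReaching⁻ em A = mk⇔ to from
    where
    to : ArcReaching D A → PointReaching (delSinks D) (A ∘ proj₁)
    to ar (v , v∉Sink) with em {∃ λ w → Arc D v w}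
    ... | no noOut = ⊥-elim (v∉Sink noOut)
    ... | yes (w , a) with ar v w a
    ... | s , s∈A , r with reach-lift r v∉Sink
    ... | s∉Sink , r⁻ = (s , s∉Sink) , s∈A , r⁻

    from : PointReaching (delSinks D) (A ∘ proj₁) → ArcReaching D A
    from pr u v a with pr (u , λ noOut → noOut (v , a))
    ... | s , s∈A , r = proj₁ s , s∈A , reach-forget r

  embUnion-split : ExcludedMiddle 0ℓ → (A : VSet D) → A ≐ embUnion D (A ∘ proj₁) (A ∩ Sink D)
  embUnion-split em A = split , merge
    where
    split : A ⊆ embUnion D (A ∘ proj₁) (A ∩ Sink D)
    split {x} x∈A with em {Sink D x}
    ... | yes x∈Sink = inj₂ (x∈A , x∈Sink)
    ... | no  x∉Sink = inj₁ (x∉Sink , x∈A)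

    merge : embUnion D (A ∘ proj₁) (A ∩ Sink D) ⊆ A
    merge (inj₁ (_ , x∈A)) = x∈A
    merge (inj₂ (x∈A , _)) = x∈A

  PointReaching⇒Isolate⊆ : ∀ {S : VSet D} → PointReaching D S → Isolate D ⊆ S
  PointReaching⇒Isolate⊆ pr {x} (_ , noIn) with pr x
  ... | s , s∈S , r with reach-into-sourceless r noIn
  ... | refl = s∈S

  ArcReaching-∖Isolate : ∀ {S : VSet D} → ArcReaching D S → ArcReaching D (S ∖ Isolate D)
  ArcReaching-∖Isolate ar u v a with ar u v a
  ... | s , s∈S , r = s , (s∈S , reach-tail⇒¬Isolate r a) , r

  PointReaching⇒ArcReaching : ∀ {S : VSet D} → PointReaching D S → ArcReaching D S
  PointReaching⇒ArcReaching pr u _ _ = pr u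

  ArcReaching⇒PointReaching-∪Isolate : ExcludedMiddle 0ℓ → ∀ {S : VSet D} →
    ArcReaching D S → PointReaching D (S ∪ Isolate D)
  ArcReaching⇒PointReaching-∪Isolate em {S} ar v with em {∃ λ s → S s × Reach D s v}
  ... | yes (s , s∈S , r) = s , inj₁ s∈S , r
  ... | no unreached = v , inj₂ (noOut , noIn) , here
    where
    noOut : ¬ (∃ λ w → Arc D v w)
    noOut (w , a) = unreached (ar v w a)

    noIn : ¬ (∃ λ w → Arc D w v)
    noIn (w , a) with ar w v a
    ... | s , s∈S , r = unreached (s , s∈S , reach-snoc r a)

  ArcBasis⇒PointBasis-∪Isolate : ExcludedMiddle 0ℓ → ∀ {A : VSet D} →
    ArcBasis D A → PointBasis D (A ∪ Isolate D)
  ArcBasis⇒PointBasis-∪Isolate em {A} (ar , minimal) =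
    ArcReaching⇒PointReaching-∪Isolate em ar , below
    where
    below : ∀ S → S ⊆ A ∪ Isolate D → PointReaching D S → A ∪ Isolate D ⊆ S
    below S S⊆ pr (inj₂ x∈I) = PointReaching⇒Isolate⊆ pr x∈I
    below S S⊆ pr (inj₁ x∈A) =
      proj₁ (minimal (S ∖ Isolate D) S∖I⊆A (ArcReaching-∖Isolate (PointReaching⇒ArcReaching pr)) x∈A)
      where
      S∖I⊆A : S ∖ Isolate D ⊆ A
      S∖I⊆A (x∈S , x∉I) with S⊆ x∈S
      ... | inj₁ x∈A = x∈A
      ... | inj₂ x∈I = ⊥-elim (x∉I x∈I)

  ArcBasis⇒disjoint-Isolate : ∀ {A : VSet D} → ArcBasis D A → A ⊆ A ∖ Isolate D
  ArcBasis⇒disjoint-Isolate (ar , minimal) = minimal _ proj₁ (ArcReaching-∖Isolate ar)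

  PointBasis⇒ArcBasis-∖Isolate : ExcludedMiddle 0ℓ → ∀ {B : VSet D} →
    PointBasis D B → ArcBasis D (B ∖ Isolate D)
  PointBasis⇒ArcBasis-∖Isolate em {B} (pr , minimal) =
    ArcReaching-∖Isolate (PointReaching⇒ArcReaching pr) , below
    where
    below : ∀ S → S ⊆ B ∖ Isolate D → ArcReaching D S → B ∖ Isolate D ⊆ S
    below S S⊆ ar (x∈B , x∉I) with minimal (S ∪ Isolate D) S∪I⊆B
                                     (ArcReaching⇒PointReaching-∪Isolate em ar) x∈B
      where
      S∪I⊆B : S ∪ Isolate D ⊆ B
      S∪I⊆B (inj₁ x∈S) = proj₁ (S⊆ x∈S)
      S∪I⊆B (inj₂ x∈I) = PointReaching⇒Isolate⊆ pr x∈I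
    ... | inj₁ x∈S = x∈S
    ... | inj₂ x∈I = ⊥-elim (x∉I x∈I)

  Minimal-resp-≐ : ∀ {R : VSet D → Set} {S T : VSet D} →
    (∀ {U V} → U ⊆ V → R U → R V) → S ≐ T → Minimal D R S → Minimal D R T
  Minimal-resp-≐ mono (S⊆T , T⊆S) (rS , minimal) =
    mono S⊆T rS , λ U U⊆T rU x∈T → minimal U (T⊆S ∘ U⊆T) rU (T⊆S x∈T)

theorem4 : ExcludedMiddle 0ℓ → (D : Digraph) →
    (∀ (A : VSet D) →
      ArcReaching D A ⇔
        (∃ λ (P : VSet (delSinks D)) → ∃ λ (Q : VSet D) →
          PointReaching (delSinks D) P × Q ⊆ Sink D × A ≐ embUnion D P Q))
    ×
    (∀ (A : VSet D) →
      ArcBasis D A ⇔ (∃ λ (B : VSet D) → PointBasis D B × A ≐ (B ∖ Isolate D)))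
theorem4 em D = (λ A → mk⇔ (decompose A) (recompose A))
              , (λ A → mk⇔ (toPointBasis A) (fromPointBasis A))
  where
  decompose : ∀ A → ArcReaching D A →
              ∃ λ P → ∃ λ Q → PointReaching (delSinks D) P × Q ⊆ Sink D × A ≐ embUnion D P Q
  decompose A ar = A ∘ proj₁ , A ∩ Sink D
                 , Equivalence.to (ArcReaching⇔PointReaching⁻ D em A) ar
                 , (λ {_} → proj₂) , embUnion-split D em A

  recompose : ∀ A → (∃ λ P → ∃ λ Q → PointReaching (delSinks D) P × Q ⊆ Sink D × A ≐ embUnion D P Q) →
              ArcReaching D A
  recompose A (_ , _ , pr , _ , _ , A⊇) = Equivalence.from (ArcReaching⇔PointReaching⁻ D em A)
    (PointReaching-mono (delSinks D) (λ { {_ , x∉Sink} x∈P → A⊇ (inj₁ (x∉Sink , x∈P)) }) pr)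

  toPointBasis : ∀ A → ArcBasis D A → ∃ λ B → PointBasis D B × A ≐ (B ∖ Isolate D)
  toPointBasis A basis = A ∪ Isolate D , ArcBasis⇒PointBasis-∪Isolate D em basis
    , (λ x∈A → inj₁ x∈A , proj₂ (ArcBasis⇒disjoint-Isolate D basis x∈A))
    , λ { (inj₁ x∈A , _) → x∈A ; (inj₂ x∈I , x∉I) → ⊥-elim (x∉I x∈I) }

  fromPointBasis : ∀ A → (∃ λ B → PointBasis D B × A ≐ (B ∖ Isolate D)) → ArcBasis D A
  fromPointBasis A (B , basis , A≐) = Minimal-resp-≐ D (ArcReaching-mono D)
    (proj₂ A≐ , proj₁ A≐) (PointBasis⇒ArcBasis-∖Isolate D em basis)
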